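{- Let $m,n\in\mathbb N$, let $\pi^-,\pi^+\in\mathscr P_m(n)$, and let $c:\mathbb R^{m+1}\times\mathbb R^{m+1}\to\mathbb R$ be a metric-like cost function. Then there exists a bijection $f\in\mathscr F(\pi^-,\pi^+)$ which minimizes $\sum_{z\in\operatorname{spt}(\delta_{\pi^- })} c(z,f(z))$ over $\mathscr F(\pi^-,\pi^+)$ and which is the identity on $\operatorname{spt}(\delta_{\pi^- })\cap\operatorname{spt}(\delta_{\pi^+})$.
   Context: An $m$-dimensional partition of $n\in\mathbb N$ is an array $\pi=(n_{i_1\dots i_m})$ of positive integers indexed by $1\le i_j\le k_j$ ($j=1,\dots,m$) for some $1\le k_1,\dots,k_m\le n$, which is monotone decreasing in each index $i_j$ separately, with $\sum_{i_1=1}^{k_1}\cdots\sum_{i_m=1}^{k_m} n_{i_1\dots i_m}=n$; $\mathscr P_m(n)$ is the set of these. For such $\pi$, let $\xi_{i_1\dots i_m\alpha}$ be the center of the cube $[i_1-1,i_1]\times\cdots\times[i_m-1,i_m]\times[\alpha-1,\alpha]\subset\mathbb R^{m+1}$ and $\delta_\pi:=\sum_{i_1=1}^{k_1}\cdots\sum_{i_m=1}^{k_m}\sum_{\alpha=1}^{n_{i_1\dots i_m}}\delta_{\xi_{i_1\dots i_m\alpha}}$ (sum of unit point masses); its support $\operatorname{spt}(\delta_\pi)$ consists of exactly $n$ points. $\mathscr F(\pi^-,\pi^+)$ denotes the (finite) set of bijections $\operatorname{spt}(\delta_{\pi^- })\to\operatorname{spt}(\delta_{\pi^+})$. A measurable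 cost function $c$ is metric-like if $c\ge0$ with $c(x,y)=0$ iff $x=y$, $c(x,y)=c(y,x)$, and $c(x,z)\le c(x,y)+c(y,z)$ for all $x,y,z$. -}

module Defs where

open import Level using (Level; suc; _⊔_)
open import Data.Nat as ℕ using (ℕ; _≤_; _<_)
open import Data.Fin using (Fin)
open import Data.Vec using (Vec; []; _∷_; lookup; _[_]≔_)
open import Data.Vec.Relation.Unary.All using (All)
open import Data.List as List using (List; []; _∷_; concatMap; map; applyUpTo; foldr)
open import Data.Nat.ListAction using (sum)
open import Data.Product using (Σ; _×_; _,_; ∃)
open import Relation.Binary.PropositionalEquality using (_≡_)
open import Data.Sum using (_⊎_)
open import Relation.Nullary using (¬_)

-- Value domain for costs.
-- There are no real numbers in agda-stdlib; we abstract over any totally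
-- ordered commutative monoid with monotone addition (ℝ with +, 0, ≤ is
-- an instance).

record OrderedValues (a ℓ : Level) : Set (suc (a ⊔ ℓ)) where
  infixl 6 _+_
  infix 4 _≼_
  field
    Carrier    : Set a
    _+_        : Carrier → Carrier → Carrier
    0#         : Carrier
    _≼_        : Carrier → Carrier → Set ℓ
    +-assoc    : ∀ x y z → (x + y) + z ≡ x + (y + z)
    +-comm     : ∀ x y → x + y ≡ y + x
    +-identityˡ : ∀ x → 0# + x ≡ x
    ≼-refl     : ∀ {x} → x ≼ x
    ≼-trans    : ∀ {x y z} → x ≼ y → y ≼ z → x ≼ z
    ≼-antisym  : ∀ {x y} → x ≼ y → y ≼ x → x ≡ y
    ≼-total    : ∀ x y → x ≼ y ⊎ y ≼ x
    +-mono-≼   : ∀ {x x′ y y′} → x ≼ x′ → y ≼ y′ → x + y ≼ x′ + y′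

-- Multi-indices (i₁,…,iₘ) are 1-based and
-- stored as Vec ℕ m.

Index : ℕ → Set
Index m = Vec ℕ m

box : ∀ {m} → Vec ℕ m → List (Index m)
box []       = [] ∷ []
box (k ∷ ks) = concatMap (λ i → map (i ∷_) (box ks)) (applyUpTo ℕ.suc k)

InBox : ∀ {m} → Vec ℕ m → Index m → Set
InBox []       []       = Data.Unit.⊤ where import Data.Unit
InBox (k ∷ ks) (i ∷ is) = (1 ≤ i × i ≤ k) × InBox ks is

record Partition (m n : ℕ) : Set where
  field
    k        : Vec ℕ m
    k-bounds : All (λ kⱼ → 1 ≤ kⱼ × kⱼ ≤ n) k
    entry    : Index m → ℕ
    positive : ∀ i → InBox k i → 1 ≤ entry i
    outside  : ∀ i → ¬ InBox k i → entry i ≡ 0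
    decreasing : ∀ (i : Index m) (j : Fin m) (t : ℕ) →
                 InBox k i → InBox k (i [ j ]≔ t) → lookup i j ≤ t →
                 entry (i [ j ]≔ t) ≤ entry i
    total    : sum (map entry (box k)) ≡ n

-- Points of spt(δ_π).  The point (i₁,…,iₘ,α) with positive integer
-- coordinates stands for the cube centre ξ_{i₁…iₘα} = (i₁-½,…,iₘ-½,α-½)
-- ∈ ℝ^{m+1}; this correspondence is injective.

Point : ℕ → Set
Point m = Index m × ℕ

InSpt : ∀ {m n} → Partition m n → Point m → Set
InSpt π (i , α) = InBox (Partition.k π) i × (1 ≤ α × α ≤ Partition.entry π i)

sptList : ∀ {m n} → Partition m n → List (Point m)
sptList π = concatMap (λ i → map (i ,_) (applyUpTo ℕ.suc (Partition.entry π i)))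
                      (box (Partition.k π))

module _ {a ℓ} (V : OrderedValues a ℓ) where
  open OrderedValues V

  record MetricLike {m : ℕ} (c : Point m → Point m → Carrier) : Set (a ⊔ ℓ) where
    field
      nonneg   : ∀ x y → 0# ≼ c x y
      zero-iff : ∀ x y → (c x y ≡ 0# → x ≡ y) × (x ≡ y → c x y ≡ 0#)
      symm     : ∀ x y → c x y ≡ c y x
      triangle : ∀ x y z → c x z ≼ c x y + c y z

  cost : ∀ {m n} → (Point m → Point m → Carrier) → Partition m n →
         (Point m → Point m) → Carrier
  cost c π⁻ f = foldr (λ z s → c z (f z) + s) 0# (sptList π⁻)

-- 𝓕(π⁻,π⁺): maps that restrict to a bijection spt(δ_{π⁻}) → spt(δ_{π⁺}).
-- (Values off spt(δ_{π⁻}) are irrelevant.)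

record IsSptBijection {m n} (π⁻ π⁺ : Partition m n) (f : Point m → Point m) : Set where
  field
    maps-to    : ∀ z → InSpt π⁻ z → InSpt π⁺ (f z)
    injective  : ∀ z w → InSpt π⁻ z → InSpt π⁻ w → f z ≡ f w → z ≡ w
    surjective : ∀ y → InSpt π⁺ y → ∃ λ z → InSpt π⁻ z × f z ≡ y

{-# OPTIONS --safe #-}

-- There are finitely many maps spt(δ_{π⁻}) → spt(δ_{π⁺}), so among the bijections one of
-- minimal cost exists.  A minimiser can then be made to fix every common point x of the
-- two supports without raising its cost: if g x ≠ x, pick w with g w = x and pass to g ∘ (x w).
-- Only the terms at x and w change, from c(x, g x) + c(w, x) to c(x, x) + c(w, g x) = c(w, g x),
-- which is no larger by the triangle inequality; points fixed by g stay fixed, so the common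
-- points can be fixed one at a time.

module Submission where

open import Defs
open import Data.Bool using (if_then_else_)
open import Data.Nat as ℕ using (ℕ; suc; _≤_; z≤n; s≤s)
open import Data.Nat.ListAction using (sum)
import Data.Nat.Properties as ℕ
open import Data.Vec using (Vec; []; _∷_)
import Data.Vec.Properties as Vec
import Data.Product.Properties as Product
open import Data.List using (List; []; _∷_; _++_; map; concatMap; applyUpTo; length; foldr; filter)
open import Data.List.Properties using (length-++; length-map; length-applyUpTo; map-cong)
open import Data.List.Relation.Unary.Any as Any using (here; there)
open import Data.List.Relation.Unary.All using (All; []; _∷_)
import Data.List.Relation.Unary.All as All
import Data.List.Relation.Unary.All.Properties as All
open import Data.List.Relation.Unary.AllPairs as AllPairs using ([]; _∷_)
import Data.List.Relation.Unary.AllPairs.Properties as AllPairs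
open import Data.List.Membership.Propositional using (_∈_; find; lose)
open import Data.List.Membership.Propositional.Properties
open import Data.List.Relation.Binary.Disjoint.Propositional using (Disjoint)
open import Data.List.Relation.Unary.Unique.Propositional using (Unique)
import Data.List.Relation.Unary.Unique.Propositional.Properties as Unique
open import Data.Product using (Σ; _×_; _,_; ∃; ∃₂; proj₁; proj₂)
open import Data.Sum using (_⊎_; inj₁; inj₂)
open import Data.Unit using (tt)
open import Function using (_∘_; id)
open import Level using (Level)
open import Relation.Binary.Bundles using (TotalOrder)
open import Relation.Binary.Definitions using (DecidableEquality)
open import Relation.Binary.PropositionalEquality
open import Relation.Nullary using (Dec; yes; no; does; contradiction)
open import Relation.Nullary.Decidable using (map′; _×-dec_; _→-dec_; dec-true; dec-false)
open import Relation.Unary using (Decidable)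

private
  variable
    b : Level
    A B C : Set

module _ (f : A → B → C) where

  dependentProductWith : List A → (A → List B) → List C
  dependentProductWith xs g = concatMap (λ x → map (f x) (g x)) xs

  ∈-dependentProductWith⁺ : ∀ {xs g x y} → x ∈ xs → y ∈ g x → f x y ∈ dependentProductWith xs g
  ∈-dependentProductWith⁺ x∈xs y∈gx = ∈-concatMap⁺ _ (lose x∈xs (∈-map⁺ (f _) y∈gx))

  ∈-dependentProductWith⁻ : ∀ {xs g z} → z ∈ dependentProductWith xs g →
                            ∃₂ λ x y → x ∈ xs × y ∈ g x × z ≡ f x y
  ∈-dependentProductWith⁻ {xs} z∈ with find (∈-concatMap⁻ _ {xs} z∈)
  ... | x , x∈xs , z∈map with ∈-map⁻ (f x) z∈map
  ...   | y , y∈gx , refl = x , y , x∈xs , y∈gx , refl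

  length-dependentProductWith : ∀ xs g → length (dependentProductWith xs g) ≡ sum (map (length ∘ g) xs)
  length-dependentProductWith []       g = refl
  length-dependentProductWith (x ∷ xs) g = begin
    length (map (f x) (g x) ++ dependentProductWith xs g)
      ≡⟨ length-++ (map (f x) (g x)) ⟩
    length (map (f x) (g x)) ℕ.+ length (dependentProductWith xs g)
      ≡⟨ cong₂ ℕ._+_ (length-map (f x) (g x)) (length-dependentProductWith xs g) ⟩
    length (g x) ℕ.+ sum (map (length ∘ g) xs) ∎
    where open ≡-Reasoning

  dependentProductWith⁺ : (∀ {x x′ y y′} → f x y ≡ f x′ y′ → x ≡ x′ × y ≡ y′) →
                          ∀ {xs g} → (∀ x → Unique (g x)) → Unique xs →
                          Unique (dependentProductWith xs g)
  dependentProductWith⁺ f-injective {xs} {g} g-unique xs-unique =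
    Unique.concat⁺ (All.map⁺ (All.tabulate (λ {x} _ → Unique.map⁺ (proj₂ ∘ f-injective) (g-unique x))))
                   (AllPairs.map⁺ (AllPairs.map disjoint xs-unique))
    where
    disjoint : ∀ {x x′} → x ≢ x′ → Disjoint (map (f x) (g x)) (map (f x′) (g x′))
    disjoint x≢x′ (z∈ , z∈′) with ∈-map⁻ _ z∈ | ∈-map⁻ _ z∈′
    ... | _ , _ , refl | _ , _ , eq = x≢x′ (proj₁ (f-injective eq))

∈-applyUpTo-suc⁺ : ∀ {k v} → 1 ≤ v → v ≤ k → v ∈ applyUpTo suc k
∈-applyUpTo-suc⁺ {v = suc v} (s≤s z≤n) v<k = ∈-applyUpTo⁺ suc v<k

∈-applyUpTo-suc⁻ : ∀ {k v} → v ∈ applyUpTo suc k → 1 ≤ v × v ≤ k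
∈-applyUpTo-suc⁻ v∈ with ∈-applyUpTo⁻ suc v∈
... | _ , i<k , refl = s≤s z≤n , i<k

applyUpTo-suc-Unique : ∀ k → Unique (applyUpTo suc k)
applyUpTo-suc-Unique k = Unique.applyUpTo⁺₁ suc k (λ i<j _ → ℕ.<⇒≢ i<j ∘ ℕ.suc-injective)

module _ {a ℓ} (V : OrderedValues a ℓ) where
  open OrderedValues V

  sumOver : (A → Carrier) → List A → Carrier
  sumOver t = foldr (λ z s → t z + s) 0#

  sumOver-cong : ∀ {t t′ : A → Carrier} xs → (∀ {z} → z ∈ xs → t z ≡ t′ z) →
                 sumOver t xs ≡ sumOver t′ xs
  sumOver-cong []       _   = refl
  sumOver-cong (x ∷ xs) t≗t′ = cong₂ _+_ (t≗t′ (here refl)) (sumOver-cong xs (t≗t′ ∘ there))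

  ≼-totalOrder : TotalOrder a a ℓ
  ≼-totalOrder = record
    { Carrier = Carrier
    ; _≈_ = _≡_
    ; _≤_ = _≼_
    ; isTotalOrder = record
      { isPartialOrder = record
        { isPreorder = record
          { isEquivalence = isEquivalence
          ; reflexive = λ { refl → ≼-refl }
          ; trans = ≼-trans
          }
        ; antisym = ≼-antisym
        }
      ; total = ≼-total
      }
    }

module WithDecidableEquality {A : Set} (_≟_ : DecidableEquality A) where

  infixl 9 _[_↦_]
  _[_↦_] : {B : Set b} → (A → B) → A → B → A → B
  (f [ x ↦ v ]) z = if does (z ≟ x) then v else f z

  module _ {B : Set b} (f : A → B) (x : A) (v : B) where

    update-≡ : (f [ x ↦ v ]) x ≡ v
    update-≡ = cong (if_then v else f x) (dec-true (x ≟ x) refl)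

    update-≢ : ∀ {z} → z ≢ x → (f [ x ↦ v ]) z ≡ f z
    update-≢ {z} z≢x = cong (if_then v else f z) (dec-false (z ≟ x) z≢x)

  transpose : A → A → A → A
  transpose x w = id [ w ↦ x ] [ x ↦ w ]

  data TransposeView (x w y : A) : A → Set where
    at-x      : y ≡ x → TransposeView x w y w
    at-w      : y ≢ x → y ≡ w → TransposeView x w y x
    elsewhere : y ≢ x → y ≢ w → TransposeView x w y y

  transposeView : ∀ x w y → TransposeView x w y (transpose x w y)
  transposeView x w y with y ≟ x | y ≟ w
  ... | yes refl | _        = at-x refl
  ... | no y≢x   | yes refl = at-w y≢x refl
  ... | no y≢x   | no y≢w   = elsewhere y≢x y≢w

  module _ {x w : A} where

    transpose-x : transpose x w x ≡ w
    transpose-x = update-≡ (id [ w ↦ x ]) x w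

    transpose-w : transpose x w w ≡ x
    transpose-w with transpose x w w | transposeView x w w
    ... | _ | at-x w≡x        = w≡x
    ... | _ | at-w _ _        = refl
    ... | _ | elsewhere _ w≢w = contradiction refl w≢w

    transpose-other : ∀ {y} → y ≢ x → y ≢ w → transpose x w y ≡ y
    transpose-other y≢x y≢w = trans (update-≢ (id [ w ↦ x ]) x w y≢x) (update-≢ id w x y≢w)

    transpose-involutive : ∀ y → transpose x w (transpose x w y) ≡ y
    transpose-involutive y with transpose x w y | transposeView x w y
    ... | _ | at-x refl         = transpose-w
    ... | _ | at-w _ refl       = transpose-x
    ... | _ | elsewhere y≢x y≢w = transpose-other y≢x y≢w

  module _ {B : Set b} (d : A → B) where

    tabulations : List A → List B → List (A → B)
    tabulations []       ys = d ∷ []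
    tabulations (x ∷ xs) ys = concatMap (λ y → map (_[ x ↦ y ]) (tabulations xs ys)) ys

    tabulations-complete : ∀ xs ys (g : A → B) → All (λ z → g z ∈ ys) xs →
                           ∃ λ t → t ∈ tabulations xs ys × All (λ z → t z ≡ g z) xs
    tabulations-complete []       ys g []             = d , here refl , []
    tabulations-complete (x ∷ xs) ys g (gx∈ys ∷ g∈ys) with tabulations-complete xs ys g g∈ys
    ... | t , t∈ , t≗g = t [ x ↦ g x ] , t′∈ , update-≡ t x (g x) ∷ All.map agree t≗g
      where
      t′∈ : t [ x ↦ g x ] ∈ tabulations (x ∷ xs) ys
      t′∈ = ∈-concatMap⁺ _ (lose gx∈ys (∈-map⁺ _ t∈))
      agree : ∀ {z} → t z ≡ g z → (t [ x ↦ g x ]) z ≡ g z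
      agree {z} tz≡gz with z ≟ x
      ... | yes refl = refl
      ... | no _     = tz≡gz

    zipMap : List A → List B → A → B
    zipMap (x ∷ xs) (y ∷ ys) = zipMap xs ys [ x ↦ y ]
    zipMap _        _        = d

    private
      zipMap-∷ : ∀ {x xs y ys z} → z ∈ x ∷ xs →
                 (z ≡ x × zipMap (x ∷ xs) (y ∷ ys) z ≡ y) ⊎
                 (z ≢ x × z ∈ xs × zipMap (x ∷ xs) (y ∷ ys) z ≡ zipMap xs ys z)
      zipMap-∷ {x} {xs} {y} {ys} {z} z∈ with z ≟ x | z∈
      ... | yes refl | _          = inj₁ (refl , refl)
      ... | no z≢x   | here z≡x   = contradiction z≡x z≢x
      ... | no z≢x   | there z∈xs = inj₂ (z≢x , z∈xs , refl)

    zipMap-∈ : ∀ xs ys → length xs ≡ length ys → ∀ {z} → z ∈ xs → zipMap xs ys z ∈ ys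
    zipMap-∈ (x ∷ xs) (y ∷ ys) |xs|≡|ys| z∈ with zipMap-∷ {ys = ys} z∈
    ... | inj₁ (_ , eq)          = here eq
    ... | inj₂ (_ , z∈xs , eq)   =
      there (subst (_∈ ys) (sym eq) (zipMap-∈ xs ys (ℕ.suc-injective |xs|≡|ys|) z∈xs))

    zipMap-injective : ∀ xs ys → length xs ≡ length ys → Unique ys →
                       ∀ {z z′} → z ∈ xs → z′ ∈ xs → zipMap xs ys z ≡ zipMap xs ys z′ → z ≡ z′
    zipMap-injective (x ∷ xs) (y ∷ ys) |xs|≡|ys| (y∉ys ∷ ys-unique) z∈ z′∈ eq
      with zipMap-∷ {ys = ys} z∈ | zipMap-∷ {ys = ys} z′∈
    ... | inj₁ (refl , _)        | inj₁ (refl , _)         = refl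
    ... | inj₁ (_ , fz≡y)        | inj₂ (_ , z′∈xs , fz′≡) =
      contradiction (trans (sym fz≡y) (trans eq fz′≡))
                    (All.lookup y∉ys (zipMap-∈ xs ys (ℕ.suc-injective |xs|≡|ys|) z′∈xs))
    ... | inj₂ (_ , z∈xs , fz≡)  | inj₁ (_ , fz′≡y)        =
      contradiction (trans (sym fz′≡y) (trans (sym eq) fz≡))
                    (All.lookup y∉ys (zipMap-∈ xs ys (ℕ.suc-injective |xs|≡|ys|) z∈xs))
    ... | inj₂ (_ , z∈xs , fz≡)  | inj₂ (_ , z′∈xs , fz′≡) =
      zipMap-injective xs ys (ℕ.suc-injective |xs|≡|ys|) ys-unique z∈xs z′∈xs (trans (sym fz≡) (trans eq fz′≡))

    zipMap-surjective : ∀ xs ys → length xs ≡ length ys → Unique xs →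
                        ∀ {y} → y ∈ ys → ∃ λ z → z ∈ xs × zipMap xs ys z ≡ y
    zipMap-surjective (x ∷ xs) (y ∷ ys) _ _ (here refl) = x , here refl , update-≡ (zipMap xs ys) x y
    zipMap-surjective (x ∷ xs) (y ∷ ys) |xs|≡|ys| (x∉xs ∷ xs-unique) (there y′∈ys)
      with zipMap-surjective xs ys (ℕ.suc-injective |xs|≡|ys|) xs-unique y′∈ys
    ... | z , z∈xs , fz≡y′ =
      z , there z∈xs , trans (update-≢ (zipMap xs ys) x y (λ z≡x → All.lookup x∉xs z∈xs (sym z≡x))) fz≡y′

  module _ {a ℓ} (V : OrderedValues a ℓ) where
    open OrderedValues V
    open import Relation.Binary.Reasoning.PartialOrder (TotalOrder.poset (≼-totalOrder V))

    sumOver-split : ∀ (t : A → Carrier) {x xs} → Unique xs → x ∈ xs →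
                    sumOver V t xs ≡ t x + sumOver V (t [ x ↦ 0# ]) xs
    sumOver-split t {xs = x ∷ xs} (x∉xs ∷ _) (here refl) = cong (t x +_) (begin-equality
      sumOver V t xs                                 ≡⟨ sumOver-cong V xs (λ z∈ → sym (update-≢ t x 0# (λ z≡x → All.lookup x∉xs z∈ (sym z≡x)))) ⟩
      sumOver V (t [ x ↦ 0# ]) xs                    ≡⟨ sym (+-identityˡ _) ⟩
      0# + sumOver V (t [ x ↦ 0# ]) xs               ≡⟨ cong (_+ sumOver V (t [ x ↦ 0# ]) xs) (sym (update-≡ t x 0#)) ⟩
      (t [ x ↦ 0# ]) x + sumOver V (t [ x ↦ 0# ]) xs ∎)
    sumOver-split t {x} {y ∷ xs} (y∉xs ∷ xs-unique) (there x∈xs) = begin-equality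
      t y + sumOver V t xs ≡⟨ cong (t y +_) (sumOver-split t xs-unique x∈xs) ⟩
      t y + (t x + rest)   ≡⟨ sym (+-assoc (t y) (t x) rest) ⟩
      (t y + t x) + rest   ≡⟨ cong (_+ rest) (+-comm (t y) (t x)) ⟩
      (t x + t y) + rest   ≡⟨ +-assoc (t x) (t y) rest ⟩
      t x + (t y + rest)   ≡⟨ cong (λ v → t x + (v + rest)) (sym (update-≢ t x 0# y≢x)) ⟩
      t x + sumOver V (t [ x ↦ 0# ]) (y ∷ xs) ∎
      where
      rest : Carrier
      rest = sumOver V (t [ x ↦ 0# ]) xs
      y≢x : y ≢ x
      y≢x refl = All.lookup y∉xs x∈xs refl

    sumOver-exchange : ∀ (t t′ : A → Carrier) {x w xs} → Unique xs → x ∈ xs → w ∈ xs → w ≢ x →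
                       (∀ {y} → y ≢ x → y ≢ w → t′ y ≡ t y) → t′ x + t′ w ≼ t x + t w →
                       sumOver V t′ xs ≼ sumOver V t xs
    sumOver-exchange t t′ {x} {w} {xs} xs-unique x∈xs w∈xs w≢x t′≗t t′≼t = begin
      sumOver V t′ xs                          ≡⟨ split₂ t′ ⟩
      (t′ x + t′ w) + sumOver V (zeroed t′) xs ≡⟨ cong ((t′ x + t′ w) +_) (sumOver-cong V xs (λ {y} _ → zeroed-agree y)) ⟩
      (t′ x + t′ w) + sumOver V (zeroed t) xs  ≤⟨ +-mono-≼ t′≼t ≼-refl ⟩
      (t x + t w) + sumOver V (zeroed t) xs    ≡⟨ split₂ t ⟨
      sumOver V t xs                           ∎
      where
      zeroed : (A → Carrier) → A → Carrier
      zeroed s = s [ x ↦ 0# ] [ w ↦ 0# ]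

      split₂ : ∀ s → sumOver V s xs ≡ (s x + s w) + sumOver V (zeroed s) xs
      split₂ s = begin-equality
        sumOver V s xs                                     ≡⟨ sumOver-split s xs-unique x∈xs ⟩
        s x + sumOver V (s [ x ↦ 0# ]) xs                  ≡⟨ cong (s x +_) (sumOver-split (s [ x ↦ 0# ]) xs-unique w∈xs) ⟩
        s x + ((s [ x ↦ 0# ]) w + sumOver V (zeroed s) xs) ≡⟨ cong (λ v → s x + (v + sumOver V (zeroed s) xs)) (update-≢ s x 0# w≢x) ⟩
        s x + (s w + sumOver V (zeroed s) xs)              ≡⟨ +-assoc (s x) (s w) _ ⟨
        (s x + s w) + sumOver V (zeroed s) xs              ∎

      zeroed-agree : ∀ y → zeroed t′ y ≡ zeroed t y
      zeroed-agree y with y ≟ w | y ≟ x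
      ... | yes _  | _      = refl
      ... | no _   | yes _  = refl
      ... | no y≢w | no y≢x = t′≗t y≢x y≢w

_≟ₚ_ : ∀ {m} → DecidableEquality (Point m)
_≟ₚ_ = Product.≡-dec (Vec.≡-dec ℕ._≟_) ℕ._≟_

open module PointUpdates {m : ℕ} = WithDecidableEquality (_≟ₚ_ {m})

∈-box⁺ : ∀ {m} (k : Vec ℕ m) {i} → InBox k i → i ∈ box k
∈-box⁺ []       {[]}     _                    = here refl
∈-box⁺ (k ∷ ks) {i ∷ is} ((1≤i , i≤k) , is∈) =
  ∈-dependentProductWith⁺ _∷_ (∈-applyUpTo-suc⁺ 1≤i i≤k) (∈-box⁺ ks is∈)

∈-box⁻ : ∀ {m} (k : Vec ℕ m) {i} → i ∈ box k → InBox k i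
∈-box⁻ []       {[]} _ = tt
∈-box⁻ (k ∷ ks) i∈ with ∈-dependentProductWith⁻ _∷_ {applyUpTo suc k} i∈
... | _ , _ , i∈range , is∈ , refl = ∈-applyUpTo-suc⁻ i∈range , ∈-box⁻ ks is∈

box-Unique : ∀ {m} (k : Vec ℕ m) → Unique (box k)
box-Unique []       = [] ∷ []
box-Unique (k ∷ ks) =
  dependentProductWith⁺ _∷_ Vec.∷-injective (λ _ → box-Unique ks) (applyUpTo-suc-Unique k)

module _ {m n : ℕ} (π : Partition m n) where
  open Partition π

  ∈-sptList⁺ : ∀ {z} → InSpt π z → z ∈ sptList π
  ∈-sptList⁺ (i∈box , 1≤α , α≤entry) =
    ∈-dependentProductWith⁺ _,_ (∈-box⁺ k i∈box) (∈-applyUpTo-suc⁺ 1≤α α≤entry)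

  ∈-sptList⁻ : ∀ {z} → z ∈ sptList π → InSpt π z
  ∈-sptList⁻ z∈ with ∈-dependentProductWith⁻ _,_ {box k} z∈
  ... | _ , _ , i∈box , α∈range , refl = ∈-box⁻ k i∈box , ∈-applyUpTo-suc⁻ α∈range

  sptList-Unique : Unique (sptList π)
  sptList-Unique = dependentProductWith⁺ _,_ Product.,-injective (applyUpTo-suc-Unique ∘ entry) (box-Unique k)

  length-sptList : length (sptList π) ≡ n
  length-sptList = begin
    length (sptList π)                                         ≡⟨ length-dependentProductWith _,_ (box k) _ ⟩
    sum (map (length ∘ applyUpTo suc ∘ entry) (box k))         ≡⟨ cong sum (map-cong (length-applyUpTo suc ∘ entry) (box k)) ⟩
    sum (map entry (box k))                                    ≡⟨ total ⟩
    n                                                          ∎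
    where open ≡-Reasoning

inBox? : ∀ {m} (k : Vec ℕ m) → Decidable (InBox k)
inBox? []       []       = yes tt
inBox? (k ∷ ks) (i ∷ is) = ((1 ℕ.≤? i) ×-dec (i ℕ.≤? k)) ×-dec inBox? ks is

module _ {m n : ℕ} (π : Partition m n) where

  inSpt? : Decidable (InSpt π)
  inSpt? (i , α) = inBox? (Partition.k π) i ×-dec ((1 ℕ.≤? α) ×-dec (α ℕ.≤? Partition.entry π i))

  ∀-InSpt? : {P : Point m → Set} → Decidable P → Dec (∀ z → InSpt π z → P z)
  ∀-InSpt? P? = map′ (λ all z z∈spt → All.lookup all (∈-sptList⁺ π z∈spt))
                     (λ all → All.tabulate (λ z∈ → all _ (∈-sptList⁻ π z∈)))
                     (All.all? P? (sptList π))

  ∃-InSpt? : {P : Point m → Set} → Decidable P → Dec (∃ λ z → InSpt π z × P z)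
  ∃-InSpt? P? = map′ (λ any → let z , z∈ , Pz = find any in z , ∈-sptList⁻ π z∈ , Pz)
                     (λ (z , z∈spt , Pz) → lose (∈-sptList⁺ π z∈spt) Pz)
                     (Any.any? P? (sptList π))

module _ {m n : ℕ} where
  open IsSptBijection

  IsSptBijection-∘ : ∀ {π₁ π₂ π₃ : Partition m n} {g f : Point m → Point m} →
                     IsSptBijection π₂ π₃ g → IsSptBijection π₁ π₂ f →
                     IsSptBijection π₁ π₃ (g ∘ f)
  maps-to    (IsSptBijection-∘ g-bij f-bij) z z∈ = maps-to g-bij _ (maps-to f-bij z z∈)
  injective  (IsSptBijection-∘ g-bij f-bij) z w z∈ w∈ gfz≡gfw =
    injective f-bij z w z∈ w∈ (injective g-bij _ _ (maps-to f-bij z z∈) (maps-to f-bij w w∈) gfz≡gfw)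
  surjective (IsSptBijection-∘ g-bij f-bij) y y∈ with surjective g-bij y y∈
  ... | u , u∈ , gu≡y with surjective f-bij u u∈
  ...   | z , z∈ , fz≡u = z , z∈ , trans (cong _ fz≡u) gu≡y

  IsSptBijection-cong : ∀ {π⁻ π⁺ : Partition m n} {f g : Point m → Point m} →
                        (∀ {z} → InSpt π⁻ z → f z ≡ g z) →
                        IsSptBijection π⁻ π⁺ f → IsSptBijection π⁻ π⁺ g
  maps-to    (IsSptBijection-cong {π⁺ = π⁺} f≗g f-bij) z z∈ = subst (InSpt π⁺) (f≗g z∈) (maps-to f-bij z z∈)
  injective  (IsSptBijection-cong f≗g f-bij) z w z∈ w∈ gz≡gw =
    injective f-bij z w z∈ w∈ (trans (f≗g z∈) (trans gz≡gw (sym (f≗g w∈))))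
  surjective (IsSptBijection-cong f≗g f-bij) y y∈ with surjective f-bij y y∈
  ... | z , z∈ , fz≡y = z , z∈ , trans (sym (f≗g z∈)) fz≡y

  transpose-isSptBijection : ∀ {π : Partition m n} {x w} → InSpt π x → InSpt π w →
                             IsSptBijection π π (transpose x w)
  maps-to    (transpose-isSptBijection {x = x} {w} x∈ w∈) y y∈ with transpose x w y | transposeView x w y
  ... | _ | at-x _        = w∈
  ... | _ | at-w _ _      = x∈
  ... | _ | elsewhere _ _ = y∈
  injective  (transpose-isSptBijection {x = x} {w} _ _) y y′ _ _ τy≡τy′ = begin
    y                                ≡⟨ transpose-involutive y ⟨
    transpose x w (transpose x w y)  ≡⟨ cong (transpose x w) τy≡τy′ ⟩
    transpose x w (transpose x w y′) ≡⟨ transpose-involutive y′ ⟩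
    y′                               ∎
    where open ≡-Reasoning
  surjective (transpose-isSptBijection {π} {x} {w} x∈ w∈) y y∈ =
    transpose x w y , maps-to (transpose-isSptBijection {π = π} x∈ w∈) y y∈ , transpose-involutive y

module _ {m n : ℕ} (π⁻ π⁺ : Partition m n) where

  zipMap-isSptBijection : IsSptBijection π⁻ π⁺ (zipMap id (sptList π⁻) (sptList π⁺))
  zipMap-isSptBijection = record
    { maps-to    = λ z z∈ → ∈-sptList⁻ π⁺ (zipMap-∈ id _ _ |spt⁻|≡|spt⁺| (∈-sptList⁺ π⁻ z∈))
    ; injective  = λ z w z∈ w∈ → zipMap-injective id _ _ |spt⁻|≡|spt⁺| (sptList-Unique π⁺)
                                   (∈-sptList⁺ π⁻ z∈) (∈-sptList⁺ π⁻ w∈)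
    ; surjective = λ y y∈ → let z , z∈ , fz≡y = zipMap-surjective id _ _ |spt⁻|≡|spt⁺| (sptList-Unique π⁻)
                                                   (∈-sptList⁺ π⁺ y∈)
                            in z , ∈-sptList⁻ π⁻ z∈ , fz≡y
    }
    where
    |spt⁻|≡|spt⁺| : length (sptList π⁻) ≡ length (sptList π⁺)
    |spt⁻|≡|spt⁺| = trans (length-sptList π⁻) (sym (length-sptList π⁺))

  isSptBijection? : Decidable (IsSptBijection π⁻ π⁺)
  isSptBijection? f = map′
    (λ (maps , inj , surj) →
       record { maps-to = maps ; injective = λ z w z∈ w∈ → inj z z∈ w w∈ ; surjective = surj })
    (λ f-bij → IsSptBijection.maps-to f-bij , (λ z z∈ w w∈ → IsSptBijection.injective f-bij z w z∈ w∈) ,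
               IsSptBijection.surjective f-bij)
    (∀-InSpt? π⁻ (λ z → inSpt? π⁺ (f z)) ×-dec
     ∀-InSpt? π⁻ (λ z → ∀-InSpt? π⁻ (λ w → (f z ≟ₚ f w) →-dec (z ≟ₚ w))) ×-dec
     ∀-InSpt? π⁺ (λ y → ∃-InSpt? π⁻ (λ z → f z ≟ₚ y)))

module _ {a ℓ} (V : OrderedValues a ℓ) {m n : ℕ} (π⁻ π⁺ : Partition m n)
         (c : Point m → Point m → OrderedValues.Carrier V) where
  open OrderedValues V
  open IsSptBijection
  open import Data.List.Extrema (≼-totalOrder V) using (argmin; argmin-all; f[argmin]≤f[xs])
  open import Relation.Binary.Reasoning.PartialOrder (TotalOrder.poset (≼-totalOrder V))

  private
    Bij : (Point m → Point m) → Set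
    Bij = IsSptBijection π⁻ π⁺

    costOf : (Point m → Point m) → Carrier
    costOf = cost V c π⁻

  optimal-sptBijection : Σ (Point m → Point m) λ f → Bij f × (∀ g → Bij g → costOf f ≼ costOf g)
  optimal-sptBijection =
    f , argmin-all costOf (zipMap-isSptBijection π⁻ π⁺) (All.all-filter (isSptBijection? π⁻ π⁺) tabulated) , f-minimal
    where
    tabulated : List (Point m → Point m)
    tabulated = tabulations id (sptList π⁻) (sptList π⁺)

    candidates : List (Point m → Point m)
    candidates = filter (isSptBijection? π⁻ π⁺) tabulated

    -- argmin needs a default value; the zip bijection shows that some spt-bijection exists.
    f : Point m → Point m
    f = argmin costOf (zipMap id (sptList π⁻) (sptList π⁺)) candidates

    f-minimal : ∀ g → Bij g → costOf f ≼ costOf g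
    f-minimal g g-bij with tabulations-complete id (sptList π⁻) (sptList π⁺) g
                             (All.tabulate (λ z∈ → ∈-sptList⁺ π⁺ (maps-to g-bij _ (∈-sptList⁻ π⁻ z∈))))
    ... | t , t∈tabulations , t≗g = begin
      costOf f ≤⟨ All.lookup (f[argmin]≤f[xs] _ candidates) t∈candidates ⟩
      costOf t ≡⟨ sumOver-cong V (sptList π⁻) (λ z∈ → cong (c _) (All.lookup t≗g z∈)) ⟩
      costOf g ∎
      where
      t∈candidates : t ∈ candidates
      t∈candidates = ∈-filter⁺ (isSptBijection? π⁻ π⁺) t∈tabulations
                       (IsSptBijection-cong (λ z∈ → sym (All.lookup t≗g (∈-sptList⁺ π⁻ z∈))) g-bij)

  module _ (c-metric : MetricLike V c) where
    open MetricLike c-metric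

    cost-∘-transpose : ∀ g {x w} → InSpt π⁻ x → InSpt π⁻ w → w ≢ x → g w ≡ x →
                       costOf (g ∘ transpose x w) ≼ costOf g
    cost-∘-transpose g {x} {w} x∈ w∈ w≢x gw≡x =
      sumOver-exchange V (λ z → c z (g z)) (λ z → c z (g (transpose x w z))) (sptList-Unique π⁻)
        (∈-sptList⁺ π⁻ x∈) (∈-sptList⁺ π⁻ w∈) w≢x
        (λ y≢x y≢w → cong (λ v → c _ (g v)) (transpose-other y≢x y≢w)) exchange
      where
      exchange : c x (g (transpose x w x)) + c w (g (transpose x w w)) ≼ c x (g x) + c w (g w)
      exchange = begin
        c x (g (transpose x w x)) + c w (g (transpose x w w))
                              ≡⟨ cong₂ (λ u v → c x (g u) + c w (g v)) (transpose-x {x = x} {w = w}) (transpose-w {x = x} {w = w}) ⟩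
        c x (g w) + c w (g x) ≡⟨ cong (λ v → c x v + c w (g x)) gw≡x ⟩
        c x x + c w (g x)     ≡⟨ cong (_+ c w (g x)) (proj₂ (zero-iff x x) refl) ⟩
        0# + c w (g x)        ≡⟨ +-identityˡ (c w (g x)) ⟩
        c w (g x)             ≤⟨ triangle w x (g x) ⟩
        c w x + c x (g x)     ≡⟨ cong (λ v → c w v + c x (g x)) gw≡x ⟨
        c w (g w) + c x (g x) ≡⟨ +-comm (c w (g w)) (c x (g x)) ⟩
        c x (g x) + c w (g w) ∎

    fix-point : ∀ g {x} → Bij g → InSpt π⁻ x → InSpt π⁺ x →
                Σ (Point m → Point m) λ g′ →
                  Bij g′ × costOf g′ ≼ costOf g × g′ x ≡ x × (∀ {y} → g y ≡ y → g′ y ≡ y)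
    fix-point g {x} g-bij x∈⁻ x∈⁺ with g x ≟ₚ x
    ... | yes gx≡x = g , g-bij , ≼-refl , gx≡x , id
    ... | no gx≢x with surjective g-bij x x∈⁺
    ...   | w , w∈⁻ , gw≡x =
      g ∘ transpose x w , IsSptBijection-∘ g-bij (transpose-isSptBijection x∈⁻ w∈⁻) ,
      cost-∘-transpose g x∈⁻ w∈⁻ w≢x gw≡x , trans (cong g (transpose-x {x = x} {w = w})) gw≡x , keeps
      where
      w≢x : w ≢ x
      w≢x refl = gx≢x gw≡x
      keeps : ∀ {y} → g y ≡ y → g (transpose x w y) ≡ y
      keeps {y} gy≡y = trans (cong g (transpose-other y≢x y≢w)) gy≡y
        where
        y≢x : y ≢ x
        y≢x refl = gx≢x gy≡y
        y≢w : y ≢ w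
        y≢w refl = w≢x (trans (sym gy≡y) gw≡x)

    fix-points : ∀ xs → All (λ z → InSpt π⁻ z × InSpt π⁺ z) xs → ∀ g → Bij g →
                 Σ (Point m → Point m) λ g′ → Bij g′ × costOf g′ ≼ costOf g × All (λ z → g′ z ≡ z) xs
    fix-points []       []                         g g-bij = g , g-bij , ≼-refl , []
    fix-points (x ∷ xs) ((x∈⁻ , x∈⁺) ∷ xs-common) g g-bij with fix-points xs xs-common g g-bij
    ... | g₁ , g₁-bij , g₁≼g , g₁-fixes with fix-point g₁ g₁-bij x∈⁻ x∈⁺
    ...   | g₂ , g₂-bij , g₂≼g₁ , g₂x≡x , g₂-keeps =
      g₂ , g₂-bij , ≼-trans g₂≼g₁ g₁≼g , g₂x≡x ∷ All.map g₂-keeps g₁-fixes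

    fix-common-points : ∀ g → Bij g →
                        Σ (Point m → Point m) λ g′ → Bij g′ × costOf g′ ≼ costOf g ×
                          (∀ z → InSpt π⁻ z → InSpt π⁺ z → g′ z ≡ z)
    fix-common-points g g-bij =
      let g′ , g′-bij , g′≼g , g′-fixes = fix-points common common-InSpt g g-bij
      in g′ , g′-bij , g′≼g ,
         λ z z∈⁻ z∈⁺ → All.lookup g′-fixes (∈-filter⁺ (inSpt? π⁺) (∈-sptList⁺ π⁻ z∈⁻) z∈⁺)
      where
      common : List (Point m)
      common = filter (inSpt? π⁺) (sptList π⁻)
      common-InSpt : All (λ z → InSpt π⁻ z × InSpt π⁺ z) common
      common-InSpt = All.tabulate λ z∈ →
        let z∈spt⁻ , z∈⁺ = ∈-filter⁻ (inSpt? π⁺) z∈ in ∈-sptList⁻ π⁻ z∈spt⁻ , z∈⁺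

proposition3p8 : ∀ {a ℓ} (V : OrderedValues a ℓ) (m n : ℕ) (π⁻ π⁺ : Partition m n)
                 (c : Point m → Point m → OrderedValues.Carrier V) →
                 MetricLike V c →
                 Σ (Point m → Point m) λ f →
                   IsSptBijection π⁻ π⁺ f
                   × (∀ g → IsSptBijection π⁻ π⁺ g →
                        OrderedValues._≼_ V (cost V c π⁻ f) (cost V c π⁻ g))
                   × (∀ z → InSpt π⁻ z → InSpt π⁺ z → f z ≡ z)
proposition3p8 V m n π⁻ π⁺ c c-metric =
  let f₀ , f₀-bij , f₀-optimal = optimal-sptBijection V π⁻ π⁺ c
      f , f-bij , f≼f₀ , f-fixes = fix-common-points V π⁻ π⁺ c c-metric f₀ f₀-bij
  in f , f-bij , (λ g g-bij → OrderedValues.≼-trans V f≼f₀ (f₀-optimal g g-bij)) , f-fixes
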